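{- Let $k \geqslant 2$ be an integer and let $G$ be a $3$-connected graph with $v(G) \geqslant k + 3$ which has a $(k-1)$-contractible set $W$. Suppose there are four distinct vertices $v_1, v_2, v_3, v_4 \in V(G) \setminus W$ such that: (1) $v_1 v_2 \in E(G)$ and $d_{G - W}(v_i) = 2$ for every $i \in \{1,2,3,4\}$; (2) for every vertex $x \in W$ with $x v_3, x v_4 \in E(G)$, the graph $G - (W \setminus \{x\}) - \{v_1, v_2\}$ is $2$-connected; (3) $|N_G(v_3) \cap N_G(v_4) \cap W| > |W \setminus (N_G(v_1) \cup N_G(v_2))|$. Then $G$ has a $k$-contractible set.
   Context: Graphs are finite, undirected, without loops or multiple edges. $v(G)$ is the number of vertices of $G$; $d_H(v)$ is the degree of $v$ in $H$; $N_G(v)$ is the set of neighbours of $v$ in $G$. For $R \subset V(G)$, $G(R)$ is the induced subgraph on $R$ and $G - R$ is obtained by deleting $R$ and all incident edges. A set $R \subset V(G)$ is contractible if $G(R)$ is connected and $G - R$ is $2$-connected; it is $m$-contractible if moreover $|R| = m$. -}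

module Defs where

open import Data.Nat using (ℕ; _<_; _∸_)
open import Data.Bool using (Bool; true; false; T)
open import Data.Fin using (Fin)
open import Data.Fin.Subset using (Subset; _∈_; _⊆_; _─_; ∁; _∩_; ∣_∣; Nonempty)
open import Data.Vec using (tabulate)
open import Data.Product using (_×_)
open import Relation.Binary.PropositionalEquality using (_≡_)

record Graph (n : ℕ) : Set where
  field
    adj    : Fin n → Fin n → Bool
    sym    : ∀ u v → adj u v ≡ adj v u
    irrefl : ∀ v → adj v v ≡ false
open Graph public

Adj : ∀ {n} → Graph n → Fin n → Fin n → Set
Adj G u v = T (adj G u v)

Nbr : ∀ {n} → Graph n → Fin n → Subset n
Nbr G v = tabulate (adj G v)

data Reach {n} (G : Graph n) (S : Subset n) : Fin n → Fin n → Set where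
  here : ∀ {u} → u ∈ S → Reach G S u u
  step : ∀ {u w v} → u ∈ S → Adj G u w → Reach G S w v → Reach G S u v

Connected : ∀ {n} → Graph n → Subset n → Set
Connected G S = Nonempty S × (∀ u v → u ∈ S → v ∈ S → Reach G S u v)

KConnected : ∀ {n} → Graph n → ℕ → Subset n → Set
KConnected G k S = k < ∣ S ∣ × (∀ X → X ⊆ S → ∣ X ∣ < k → Connected G (S ─ X))

Contractible : ∀ {n} → Graph n → Subset n → Set
Contractible G R = Connected G R × KConnected G 2 (∁ R)

MContractible : ∀ {n} → Graph n → ℕ → Subset n → Set
MContractible G m R = Contractible G R × ∣ R ∣ ≡ m

degMinus : ∀ {n} → Graph n → Subset n → Fin n → ℕ
degMinus G W v = ∣ Nbr G v ∩ ∁ W ∣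

-- Put W⁺ = W ∪ {v₁, v₂}.  For x ∈ C = N(v₃) ∩ N(v₄) ∩ W the set W⁺ − x has k elements and,
-- by (2), a 2-connected complement, so it suffices to find x ∈ C with G(W⁺ − x) connected.
-- If W misses N(v₁) ∪ N(v₂) then C ⊆ W ∖ (N(v₁) ∪ N(v₂)), contradicting (3).  Otherwise G(W⁺)
-- is connected, and if no G(W⁺ − x) is connected then deleting each x ∈ C cuts off a nonempty
-- set of vertices from v₁.  These cut sets avoid N(v₁) ∪ N(v₂) ⊇ {v₁, v₂} and form a laminar
-- family indexed by C, so |C| ≤ |W ∖ (N(v₁) ∪ N(v₂))|, again contradicting (3).
module Submission where

open import Defs hiding (sym)
open import Data.Bool using (Bool; T)
open import Data.Bool.Properties using (T-≡)
open import Data.Empty using (⊥-elim)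
open import Data.Fin using (Fin)
open import Data.Fin.Properties using (any?) renaming (_≟_ to _≟ᶠ_)
open import Data.Fin.Subset
  using (Subset; inside; outside; ⊤; _∈_; _∉_; _⊆_; _⊂_; ∁; _∩_; _∪_; _─_; _-_; ⁅_⁆; ∣_∣; Nonempty; Empty)
open import Data.Fin.Subset.Induction using (⊂-wellFounded)
open import Data.Fin.Subset.Properties
open import Data.Nat using (ℕ; zero; suc; _≤_; _<_; _+_; _∸_; z≤n; s≤s)
open import Data.Nat.Properties using (+-suc; +-comm; suc-injective; <⇒≱)
open import Data.Product using (∃; _×_; _,_; proj₁; proj₂)
open import Data.Sum using (_⊎_; inj₁; inj₂; [_,_]′)
open import Data.Vec using (_∷_; []; here; there; tabulate)
open import Data.Vec.Properties using ([]=⇒lookup; lookup⇒[]=; lookup∘tabulate)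
open import Function using (_∘_)
open import Function.Bundles using (Equivalence)
open import Induction.WellFounded using (Acc; acc)
open import Relation.Nullary using (Dec; yes; no; ¬_; ⌊_⌋)
open import Relation.Nullary.Decidable using (_×-dec_; ¬?; T?; map′; toWitness; fromWitness)
open import Relation.Binary.PropositionalEquality
  using (_≡_; _≢_; refl; sym; trans; cong; cong₂; subst; module ≡-Reasoning)

x∈p─q⇒x∉q : ∀ {n} {p q : Subset n} {x} → x ∈ p ─ q → x ∉ q
x∈p─q⇒x∉q {p = _ ∷ _} {inside ∷ _} {Fin.zero} () _
x∈p─q⇒x∉q {p = _ ∷ _} {outside ∷ _} {Fin.zero} _ ()
x∈p─q⇒x∉q {p = _ ∷ _} {_ ∷ _} {Fin.suc x} (there m) (there m′) = x∈p─q⇒x∉q m m′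

x∈p-y⇒x≢y : ∀ {n} {p : Subset n} {x y} → x ∈ p - y → x ≢ y
x∈p-y⇒x≢y {y = y} m refl = x∈p─q⇒x∉q m (x∈⁅x⁆ y)

x∈p-y⇒x∈p : ∀ {n} {p : Subset n} {x y} → x ∈ p - y → x ∈ p
x∈p-y⇒x∈p {p = p} {y = y} = p─q⊆p p ⁅ y ⁆

x∈p⇒suc∣p-x∣≡∣p∣ : ∀ {n} {p : Subset n} {x} → x ∈ p → suc ∣ p - x ∣ ≡ ∣ p ∣
x∈p⇒suc∣p-x∣≡∣p∣ {p = inside ∷ p} {Fin.zero} here = cong (suc ∘ ∣_∣) (p─⊥≡p p)
x∈p⇒suc∣p-x∣≡∣p∣ {p = inside ∷ p} {Fin.suc x} (there m) = cong suc (x∈p⇒suc∣p-x∣≡∣p∣ m)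
x∈p⇒suc∣p-x∣≡∣p∣ {p = outside ∷ p} {Fin.suc x} (there m) = x∈p⇒suc∣p-x∣≡∣p∣ m

Disjoint : ∀ {n} → Subset n → Subset n → Set
Disjoint p q = ∀ {x} → x ∈ p → x ∉ q

Disjoint-∷ : ∀ {n a b} {p q : Subset n} → Disjoint (a ∷ p) (b ∷ q) → Disjoint p q
Disjoint-∷ p#q m m′ = p#q (there m) (there m′)

∣p∪q∣≡∣p∣+∣q∣ : ∀ {n} (p q : Subset n) → Disjoint p q → ∣ p ∪ q ∣ ≡ ∣ p ∣ + ∣ q ∣
∣p∪q∣≡∣p∣+∣q∣ [] [] _ = refl
∣p∪q∣≡∣p∣+∣q∣ (inside ∷ p) (inside ∷ q) p#q = ⊥-elim (p#q here here)
∣p∪q∣≡∣p∣+∣q∣ (inside ∷ p) (outside ∷ q) p#q = cong suc (∣p∪q∣≡∣p∣+∣q∣ p q (Disjoint-∷ p#q))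
∣p∪q∣≡∣p∣+∣q∣ (outside ∷ p) (inside ∷ q) p#q =
  trans (cong suc (∣p∪q∣≡∣p∣+∣q∣ p q (Disjoint-∷ p#q))) (sym (+-suc ∣ p ∣ ∣ q ∣))
∣p∪q∣≡∣p∣+∣q∣ (outside ∷ p) (outside ∷ q) p#q = ∣p∪q∣≡∣p∣+∣q∣ p q (Disjoint-∷ p#q)

p─r∪q≡p∪q─r : ∀ {n} (p q r : Subset n) → Disjoint q r → (p ─ r) ∪ q ≡ (p ∪ q) ─ r
p─r∪q≡p∪q─r [] [] [] _ = refl
p─r∪q≡p∪q─r (a ∷ p) (inside ∷ q) (inside ∷ r) q#r = ⊥-elim (q#r here here)
p─r∪q≡p∪q─r (inside ∷ p) (outside ∷ q) (inside ∷ r) q#r = cong (outside ∷_) (p─r∪q≡p∪q─r p q r (Disjoint-∷ q#r))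
p─r∪q≡p∪q─r (outside ∷ p) (outside ∷ q) (inside ∷ r) q#r = cong (outside ∷_) (p─r∪q≡p∪q─r p q r (Disjoint-∷ q#r))
p─r∪q≡p∪q─r (inside ∷ p) (b ∷ q) (outside ∷ r) q#r = cong (inside ∷_) (p─r∪q≡p∪q─r p q r (Disjoint-∷ q#r))
p─r∪q≡p∪q─r (outside ∷ p) (b ∷ q) (outside ∷ r) q#r = cong (b ∷_) (p─r∪q≡p∪q─r p q r (Disjoint-∷ q#r))

p-y-z⊆p-z : ∀ {n} (p : Subset n) y z → p - y - z ⊆ p - z
p-y-z⊆p-z p y z m = p─q⊆p (p - z) ⁅ y ⁆ (subst (_ ∈_) (p─x─y≡p─y─x p y z) m)

∣p∣≡suc⇒nonempty : ∀ {n m} (p : Subset n) → ∣ p ∣ ≡ suc m → Nonempty p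
∣p∣≡suc⇒nonempty {n} p ∣p∣≡ with nonempty? p
... | yes ne = ne
... | no empty with () ← trans (sym (trans (cong ∣_∣ (Empty-unique empty)) (∣⊥∣≡0 n))) ∣p∣≡

∈-tabulate⁻ : ∀ {n} (f : Fin n → Bool) {x} → x ∈ tabulate f → T (f x)
∈-tabulate⁻ f {x} m = Equivalence.from T-≡ (trans (sym (lookup∘tabulate f x)) ([]=⇒lookup m))

∈-tabulate⁺ : ∀ {n} (f : Fin n → Bool) {x} → T (f x) → x ∈ tabulate f
∈-tabulate⁺ f {x} t = lookup⇒[]= x (tabulate f) (trans (lookup∘tabulate f x) (Equivalence.to T-≡ t))

-- Walks

module _ {n} (G : Graph n) where

  Adj-sym : ∀ {u v} → Adj G u v → Adj G v u
  Adj-sym {u} {v} = subst T (Graph.sym G u v)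

  Reach-start : ∀ {S a b} → Reach G S a b → a ∈ S
  Reach-start (here a∈S) = a∈S
  Reach-start (step a∈S _ _) = a∈S

  Reach-mono : ∀ {S S′ a b} → S ⊆ S′ → Reach G S a b → Reach G S′ a b
  Reach-mono S⊆S′ (here a∈S) = here (S⊆S′ a∈S)
  Reach-mono S⊆S′ (step a∈S e r) = step (S⊆S′ a∈S) e (Reach-mono S⊆S′ r)

  Reach-trans : ∀ {S a b c} → Reach G S a b → Reach G S b c → Reach G S a c
  Reach-trans (here _) r′ = r′
  Reach-trans (step a∈S e r) r′ = step a∈S e (Reach-trans r r′)

  Reach-sym : ∀ {S a b} → Reach G S a b → Reach G S b a
  Reach-sym (here a∈S) = here a∈S
  Reach-sym (step a∈S e r) = Reach-trans (Reach-sym r) (step (Reach-start r) (Adj-sym e) (here a∈S))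

  connected-via : ∀ {S t} → t ∈ S → (∀ {w} → w ∈ S → Reach G S w t) → Connected G S
  connected-via t∈S to-t = (_ , t∈S) , λ u v u∈S v∈S → Reach-trans (to-t u∈S) (Reach-sym (to-t v∈S))

  -- The last visit to y splits a walk that may pass through y.
  Reach-avoid : ∀ {S a t y} → Reach G S a t → t ≢ y →
    Reach G (S - y) a t ⊎ ∃ λ w → Adj G y w × Reach G (S - y) w t
  Reach-avoid (here a∈S) t≢y = inj₁ (here (x∈p∧x≢y⇒x∈p-y a∈S t≢y))
  Reach-avoid {y = y} (step {u} u∈S e r) t≢y with Reach-avoid r t≢y | u ≟ᶠ y
  ... | inj₂ via-y | _ = inj₂ via-y
  ... | inj₁ r′ | yes refl = inj₂ (_ , e , r′)
  ... | inj₁ r′ | no u≢y = inj₁ (step (x∈p∧x≢y⇒x∈p-y u∈S u≢y) e r′)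

  Reach-first : ∀ {S a t y z} → Reach G S a t → t ≢ y → t ≢ z → y ≢ z →
    Reach G (S - y - z) a t ⊎ Reach G (S - z) a y ⊎ Reach G (S - y) a z
  Reach-first (here a∈S) t≢y t≢z _ = inj₁ (here (x∈p∧x≢y⇒x∈p-y (x∈p∧x≢y⇒x∈p-y a∈S t≢y) t≢z))
  Reach-first {y = y} {z} (step {u} u∈S e r) t≢y t≢z y≢z with u ≟ᶠ y | u ≟ᶠ z
  ... | yes refl | _ = inj₂ (inj₁ (here (x∈p∧x≢y⇒x∈p-y u∈S y≢z)))
  ... | no _ | yes refl = inj₂ (inj₂ (here (x∈p∧x≢y⇒x∈p-y u∈S (y≢z ∘ sym))))
  ... | no u≢y | no u≢z with Reach-first r t≢y t≢z y≢z
  ...   | inj₁ r′ = inj₁ (step (x∈p∧x≢y⇒x∈p-y (x∈p∧x≢y⇒x∈p-y u∈S u≢y) u≢z) e r′)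
  ...   | inj₂ (inj₁ r′) = inj₂ (inj₁ (step (x∈p∧x≢y⇒x∈p-y u∈S u≢z) e r′))
  ...   | inj₂ (inj₂ r′) = inj₂ (inj₂ (step (x∈p∧x≢y⇒x∈p-y u∈S u≢y) e r′))

  Reach-via-neighbour : ∀ {S u v} → Reach G S u v → u ≢ v →
    ∃ λ w → Adj G u w × Reach G (S - u) w v
  Reach-via-neighbour r u≢v with Reach-avoid r (u≢v ∘ sym)
  ... | inj₁ r′ = ⊥-elim (x∈p-y⇒x≢y (Reach-start r′) refl)
  ... | inj₂ via-u = via-u

  Reach? : ∀ S u v → Dec (Reach G S u v)
  Reach? S = decide S (⊂-wellFounded S)
    where
    decide : ∀ S → Acc _⊂_ S → ∀ u v → Dec (Reach G S u v)
    decide S (acc smaller) u v with u ∈? S | u ≟ᶠ v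
    ... | no u∉S | _ = no (u∉S ∘ Reach-start)
    ... | yes u∈S | yes refl = yes (here u∈S)
    ... | yes u∈S | no u≢v =
      map′ (λ (w , e , r) → step u∈S e (Reach-mono x∈p-y⇒x∈p r)) (λ r → Reach-via-neighbour r u≢v)
        (any? λ w → T? (adj G u w) ×-dec decide (S - u) (smaller (x∈p⇒p-x⊂p u∈S)) w v)

-- Laminar families

-- U y is to be thought of as the set of vertices that deleting y separates from a fixed root.
record Laminar {n} (U : Fin n → Subset n) (C : Subset n) : Set where
  field
    irreflexive : ∀ {y} → y ∈ C → y ∉ U y
    hereditary  : ∀ {y z} → y ∈ C → z ∈ C → z ∈ U y → U z ⊆ U y
    overlapping : ∀ {y z a} → y ∈ C → z ∈ C → y ≢ z → a ∈ U y → a ∈ U z → y ∈ U z ⊎ z ∈ U y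

module _ {n} {U : Fin n → Subset n} {C : Subset n} (L : Laminar U C) where
  open Laminar L

  Laminar-⊆ : ∀ {C′} → C′ ⊆ C → Laminar U C′
  Laminar-⊆ C′⊆C = record
    { irreflexive = irreflexive ∘ C′⊆C
    ; hereditary  = λ y∈ z∈ → hereditary (C′⊆C y∈) (C′⊆C z∈)
    ; overlapping = λ y∈ z∈ → overlapping (C′⊆C y∈) (C′⊆C z∈)
    }

  Laminar-delete : ∀ {d} → d ∉ C → Laminar (λ y → U y - d) C
  Laminar-delete {d} d∉C = record
    { irreflexive = λ y∈C → irreflexive y∈C ∘ x∈p-y⇒x∈p
    ; hereditary  = λ y∈C z∈C z∈Uy a∈Uz →
        x∈p∧x≢y⇒x∈p-y (hereditary y∈C z∈C (x∈p-y⇒x∈p z∈Uy) (x∈p-y⇒x∈p a∈Uz)) (x∈p-y⇒x≢y a∈Uz)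
    ; overlapping = λ y∈C z∈C y≢z a∈Uy a∈Uz →
        Data.Sum.map (λ m → x∈p∧x≢y⇒x∈p-y m (λ { refl → d∉C y∈C }))
                     (λ m → x∈p∧x≢y⇒x∈p-y m (λ { refl → d∉C z∈C }))
                     (overlapping y∈C z∈C y≢z (x∈p-y⇒x∈p a∈Uy) (x∈p-y⇒x∈p a∈Uz))
    }

  Laminar-minimal : ∀ {x} → x ∈ C → ∃ λ x′ → x′ ∈ C × (∀ {y} → y ∈ C → y ∉ U x′)
  Laminar-minimal {x} = descend x (⊂-wellFounded (U x))
    where
    descend : ∀ x → Acc _⊂_ (U x) → x ∈ C → ∃ λ x′ → x′ ∈ C × (∀ {y} → y ∈ C → y ∉ U x′)
    descend x (acc smaller) x∈C with any? (λ y → y ∈? C ×-dec y ∈? U x)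
    ... | no none = x , x∈C , λ y∈C y∈Ux → none (_ , y∈C , y∈Ux)
    ... | yes (y , y∈C , y∈Ux) =
      descend y (smaller (hereditary x∈C y∈C y∈Ux , y , y∈Ux , irreflexive y∈C)) y∈C

-- Delete a minimal index x together with one of its elements d, and recurse.
laminar-count : ∀ {n} m {U : Fin n → Subset n} {C D : Subset n} → ∣ C ∣ ≡ m → Laminar U C →
  (∀ {y} → y ∈ C → Nonempty (U y)) → (∀ {y} → y ∈ C → U y ⊆ D) → m ≤ ∣ D ∣
laminar-count zero _ _ _ _ = z≤n
laminar-count (suc m) {U} {C} {D} ∣C∣≡1+m L nonempty U⊆D
  with Laminar-minimal L (proj₂ (∣p∣≡suc⇒nonempty C ∣C∣≡1+m))
... | x , x∈C , minimal with nonempty x∈C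
...   | d , d∈Ux =
  subst (suc m ≤_) (x∈p⇒suc∣p-x∣≡∣p∣ (U⊆D x∈C d∈Ux))
    (s≤s (laminar-count m ∣C-x∣≡m L′ nonempty′ (U⊆D′ ∘ x∈p-y⇒x∈p)))
  where
  open Laminar L

  ∣C-x∣≡m : ∣ C - x ∣ ≡ m
  ∣C-x∣≡m = suc-injective (trans (x∈p⇒suc∣p-x∣≡∣p∣ x∈C) ∣C∣≡1+m)

  L′ : Laminar (λ y → U y - d) (C - x)
  L′ = Laminar-delete (Laminar-⊆ L x∈p-y⇒x∈p) (λ d∈C-x → minimal (x∈p-y⇒x∈p d∈C-x) d∈Ux)

  U⊆D′ : ∀ {y} → y ∈ C → U y - d ⊆ D - d
  U⊆D′ y∈C a∈ = x∈p∧x≢y⇒x∈p-y (U⊆D y∈C (x∈p-y⇒x∈p a∈)) (x∈p-y⇒x≢y a∈)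

  -- If U y contained only d, then U y and U x would overlap, so x ∈ U y by minimality of x.
  nonempty′ : ∀ {y} → y ∈ C - x → Nonempty (U y - d)
  nonempty′ {y} y∈C-x with nonempty (x∈p-y⇒x∈p y∈C-x)
  ... | a , a∈Uy with a ≟ᶠ d
  ...   | no a≢d = a , x∈p∧x≢y⇒x∈p-y a∈Uy a≢d
  ...   | yes refl with overlapping (x∈p-y⇒x∈p y∈C-x) x∈C (x∈p-y⇒x≢y y∈C-x) a∈Uy d∈Ux
  ...     | inj₁ y∈Ux = ⊥-elim (minimal (x∈p-y⇒x∈p y∈C-x) y∈Ux)
  ...     | inj₂ x∈Uy = x , x∈p∧x≢y⇒x∈p-y x∈Uy λ { refl → irreflexive x∈C d∈Ux }

-- Vertices cut off from a root

module Separation {n} (G : Graph n) (S : Subset n) (t : Fin n) where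

  Separated : Fin n → Fin n → Set
  Separated y w = w ∈ S - y × ¬ Reach G (S - y) w t

  Cut : Fin n → Subset n
  Cut y = tabulate λ w → ⌊ w ∈? S - y ×-dec ¬? (Reach? G (S - y) w t) ⌋

  Cut⁻ : ∀ {y w} → w ∈ Cut y → Separated y w
  Cut⁻ = toWitness ∘ ∈-tabulate⁻ _

  Cut⁺ : ∀ {y w} → Separated y w → w ∈ Cut y
  Cut⁺ = ∈-tabulate⁺ _ ∘ fromWitness

  ∉Cut⇒Reach : ∀ {y w} → w ∈ S - y → w ∉ Cut y → Reach G (S - y) w t
  ∉Cut⇒Reach {y} {w} w∈S-y w∉Cut with Reach? G (S - y) w t
  ... | yes r = r
  ... | no ¬r = ⊥-elim (w∉Cut (Cut⁺ (w∈S-y , ¬r)))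

  ∈Cut⇒root≢ : ∀ {y w} → w ∈ Cut y → t ≢ w
  ∈Cut⇒root≢ w∈Cut refl with Cut⁻ w∈Cut
  ... | t∈S-y , ¬t→t = ¬t→t (here t∈S-y)

  Cut-escape : ∀ {y z a} → a ∈ Cut z → y ∉ Cut z → ¬ Reach G (S - z) a y
  Cut-escape a∈Cz y∉Cz a→y =
    proj₂ (Cut⁻ a∈Cz) (Reach-trans G a→y (∉Cut⇒Reach (Reach-start G (Reach-sym G a→y)) y∉Cz))

  module _ (connected : ∀ {w} → w ∈ S → Reach G S w t) where

    Cut-asym : ∀ {y z} → z ∈ Cut y → y ∉ Cut z
    Cut-asym {y} {z} z∈Cy y∈Cz with Cut⁻ z∈Cy | Cut⁻ y∈Cz
    ... | z∈S-y , ¬z→t | y∈S-z , ¬y→t with Reach-avoid G (connected (x∈p-y⇒x∈p y∈S-z)) (∈Cut⇒root≢ z∈Cy)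
    ...   | inj₁ y→t = ¬y→t y→t
    ...   | inj₂ (u , z~u , u→t) with Reach-avoid G u→t (∈Cut⇒root≢ y∈Cz)
    ...     | inj₁ u→t′ = ¬z→t (step z∈S-y z~u (Reach-mono G (p-y-z⊆p-z S z y) u→t′))
    ...     | inj₂ (u′ , y~u′ , u′→t) = ¬y→t (step y∈S-z y~u′ (Reach-mono G x∈p-y⇒x∈p u′→t))

    Cut-hereditary : ∀ {y z} → z ∈ Cut y → Cut z ⊆ Cut y
    Cut-hereditary {y} {z} z∈Cy {w} w∈Cz with Cut⁻ z∈Cy | Cut⁻ w∈Cz
    ... | z∈S-y , ¬z→t | w∈S-z , ¬w→t = Cut⁺ (w∈S-y , ¬w→t′)
      where
      w∈S-y : w ∈ S - y
      w∈S-y = x∈p∧x≢y⇒x∈p-y (x∈p-y⇒x∈p w∈S-z) (λ { refl → Cut-asym z∈Cy w∈Cz })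
      ¬w→t′ : ¬ Reach G (S - y) w t
      ¬w→t′ w→t with Reach-avoid G w→t (∈Cut⇒root≢ z∈Cy)
      ... | inj₁ w→t″ = ¬w→t (Reach-mono G (p-y-z⊆p-z S y z) w→t″)
      ... | inj₂ (u , z~u , u→t) = ¬z→t (step z∈S-y z~u (Reach-mono G x∈p-y⇒x∈p u→t))

    -- Follow a walk from a to t until it first meets y or z.
    Cut-overlapping : ∀ {y z a} → t ≢ y → t ≢ z → y ≢ z → a ∈ Cut y → a ∈ Cut z → y ∈ Cut z ⊎ z ∈ Cut y
    Cut-overlapping {y} {z} t≢y t≢z y≢z a∈Cy a∈Cz with y ∈? Cut z | z ∈? Cut y
    ... | yes y∈Cz | _ = inj₁ y∈Cz
    ... | no _ | yes z∈Cy = inj₂ z∈Cy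
    ... | no y∉Cz | no z∉Cy with Cut⁻ a∈Cy
    ...   | a∈S-y , ¬a→t with Reach-first G (connected (x∈p-y⇒x∈p a∈S-y)) t≢y t≢z y≢z
    ...     | inj₁ a→t = ⊥-elim (¬a→t (Reach-mono G x∈p-y⇒x∈p a→t))
    ...     | inj₂ (inj₁ a→y) = ⊥-elim (Cut-escape a∈Cz y∉Cz a→y)
    ...     | inj₂ (inj₂ a→z) = ⊥-elim (Cut-escape a∈Cy z∉Cy a→z)

    Cut-laminar : Laminar Cut (∁ ⁅ t ⁆)
    Cut-laminar = record
      { irreflexive = λ _ y∈Cy → x∈p-y⇒x≢y (proj₁ (Cut⁻ y∈Cy)) refl
      ; hereditary  = λ _ _ → Cut-hereditary
      ; overlapping = λ y≢t z≢t → Cut-overlapping (≢-root y≢t) (≢-root z≢t)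
      }
      where
      ≢-root : ∀ {y} → y ∈ ∁ ⁅ t ⁆ → t ≢ y
      ≢-root y∈ t≡y = x∈∁p⇒x∉p y∈ (subst (_∈ ⁅ t ⁆) t≡y (x∈⁅x⁆ t))

module _ {n} (G : Graph n) (W : Subset n) {v₁ v₂ : Fin n}
         (v₁~v₂ : Adj G v₁ v₂) (v₁∉W : v₁ ∉ W) (v₂∉W : v₂ ∉ W) where

  private
    V N₁₂ W⁺ : Subset n
    V = ⁅ v₁ ⁆ ∪ ⁅ v₂ ⁆
    N₁₂ = Nbr G v₁ ∪ Nbr G v₂
    W⁺ = W ∪ V

  open Separation G W⁺ v₁

  V⊆N₁₂ : V ⊆ N₁₂
  V⊆N₁₂ m with x∈p∪q⁻ ⁅ v₁ ⁆ ⁅ v₂ ⁆ m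
  ... | inj₁ m₁ rewrite x∈⁅y⁆⇒x≡y v₁ m₁ = x∈p∪q⁺ (inj₂ (∈-tabulate⁺ (adj G v₂) (Adj-sym G v₁~v₂)))
  ... | inj₂ m₂ rewrite x∈⁅y⁆⇒x≡y v₂ m₂ = x∈p∪q⁺ (inj₁ (∈-tabulate⁺ (adj G v₁) v₁~v₂))

  V-disjoint-W : Disjoint V W
  V-disjoint-W m with x∈p∪q⁻ ⁅ v₁ ⁆ ⁅ v₂ ⁆ m
  ... | inj₁ m₁ rewrite x∈⁅y⁆⇒x≡y v₁ m₁ = v₁∉W
  ... | inj₂ m₂ rewrite x∈⁅y⁆⇒x≡y v₂ m₂ = v₂∉W

  Reach-v₁ : ∀ {P e} → V ⊆ P → e ∈ P → e ∈ N₁₂ → Reach G P e v₁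
  Reach-v₁ V⊆P e∈P e∈N with x∈p∪q⁻ (Nbr G v₁) (Nbr G v₂) e∈N
  ... | inj₁ m₁ = step e∈P (Adj-sym G (∈-tabulate⁻ (adj G v₁) m₁)) (here (V⊆P (x∈p∪q⁺ (inj₁ (x∈⁅x⁆ v₁)))))
  ... | inj₂ m₂ = step e∈P (Adj-sym G (∈-tabulate⁻ (adj G v₂) m₂))
                    (step (V⊆P (x∈p∪q⁺ (inj₂ (x∈⁅x⁆ v₂)))) (Adj-sym G v₁~v₂) (here (V⊆P (x∈p∪q⁺ (inj₁ (x∈⁅x⁆ v₁))))))

  W-y∪V≡W⁺-y : ∀ y → y ∈ W → (W - y) ∪ V ≡ W⁺ - y
  W-y∪V≡W⁺-y y y∈W = p─r∪q≡p∪q─r W V ⁅ y ⁆ λ e∈V e∈⁅y⁆ →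
    V-disjoint-W e∈V (subst (_∈ W) (sym (x∈⁅y⁆⇒x≡y y e∈⁅y⁆)) y∈W)

  V⊆W⁺-y : ∀ {y} → y ∈ W → V ⊆ W⁺ - y
  V⊆W⁺-y y∈W e∈V = x∈p∧x≢y⇒x∈p-y (x∈p∪q⁺ (inj₂ e∈V)) λ { refl → V-disjoint-W e∈V y∈W }

  Cut⊆W─N₁₂ : ∀ {y} → y ∈ W → Cut y ⊆ W ─ N₁₂
  Cut⊆W─N₁₂ y∈W {w} w∈Cy with Cut⁻ w∈Cy
  ... | w∈W⁺-y , ¬w→v₁ = x∈p∧x∉q⇒x∈p─q w∈W w∉N₁₂
    where
    w∉N₁₂ : w ∉ N₁₂
    w∉N₁₂ = ¬w→v₁ ∘ Reach-v₁ (V⊆W⁺-y y∈W) w∈W⁺-y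
    w∈W : w ∈ W
    w∈W = [ (λ m → m) , (λ w∈V → ⊥-elim (w∉N₁₂ (V⊆N₁₂ w∈V))) ]′ (x∈p∪q⁻ W V (x∈p-y⇒x∈p w∈W⁺-y))

  W⁺-connected : Connected G W → Nonempty (W ∩ N₁₂) → ∀ {w} → w ∈ W⁺ → Reach G W⁺ w v₁
  W⁺-connected (_ , W-walks) (u , u∈W∩N) w∈W⁺
    with x∈p∩q⁻ W N₁₂ u∈W∩N | x∈p∪q⁻ W V w∈W⁺
  ... | u∈W , u∈N | inj₁ w∈W = Reach-trans G (Reach-mono G (p⊆p∪q V) (W-walks _ _ w∈W u∈W))
                                            (Reach-v₁ (q⊆p∪q W V) (x∈p∪q⁺ (inj₁ u∈W)) u∈N)
  ... | _ | inj₂ w∈V = Reach-v₁ (q⊆p∪q W V) w∈W⁺ (V⊆N₁₂ w∈V)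

  Cut-empty⇒connected : ∀ {y} → y ∈ W → Empty (Cut y) → Connected G (W⁺ - y)
  Cut-empty⇒connected y∈W empty =
    connected-via G (V⊆W⁺-y y∈W (x∈p∪q⁺ (inj₁ (x∈⁅x⁆ v₁)))) λ w∈W⁺-y → ∉Cut⇒Reach w∈W⁺-y (empty ∘ (_ ,_))

  connected-or-∣C∣≤∣W─N₁₂∣ : Connected G W → ∀ C → C ⊆ W →
    (∃ λ y → y ∈ C × Connected G ((W - y) ∪ V)) ⊎ ∣ C ∣ ≤ ∣ W ─ N₁₂ ∣
  connected-or-∣C∣≤∣W─N₁₂∣ W-connected C C⊆W with nonempty? (W ∩ N₁₂)
  ... | no W∩N-empty = inj₂ (p⊆q⇒∣p∣≤∣q∣ λ y∈C →
        x∈p∧x∉q⇒x∈p─q (C⊆W y∈C) (λ y∈N → W∩N-empty (_ , x∈p∩q⁺ (C⊆W y∈C , y∈N))))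
  ... | yes W∩N-nonempty with any? (λ y → y ∈? C ×-dec ¬? (nonempty? (Cut y)))
  ...   | yes (y , y∈C , empty) =
          inj₁ (y , y∈C , subst (Connected G) (sym (W-y∪V≡W⁺-y y (C⊆W y∈C))) (Cut-empty⇒connected (C⊆W y∈C) empty))
  ...   | no none = inj₂ (laminar-count ∣ C ∣ refl laminar nonempty (Cut⊆W─N₁₂ ∘ C⊆W))
    where
    laminar : Laminar Cut C
    laminar = Laminar-⊆ (Cut-laminar (W⁺-connected W-connected W∩N-nonempty))
                (λ y∈C → x∉p⇒x∈∁p λ y∈⁅v₁⁆ → v₁∉W (subst (_∈ W) (x∈⁅y⁆⇒x≡y v₁ y∈⁅v₁⁆) (C⊆W y∈C)))
    nonempty : ∀ {y} → y ∈ C → Nonempty (Cut y)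
    nonempty {y} y∈C with nonempty? (Cut y)
    ... | yes ne = ne
    ... | no empty = ⊥-elim (none (y , y∈C , empty))

  ∣W-y∪V∣≡suc∣W∣ : v₁ ≢ v₂ → ∀ {y} → y ∈ W → ∣ (W - y) ∪ V ∣ ≡ suc ∣ W ∣
  ∣W-y∪V∣≡suc∣W∣ v₁≢v₂ {y} y∈W = begin
    ∣ (W - y) ∪ V ∣    ≡⟨ ∣p∪q∣≡∣p∣+∣q∣ (W - y) V (λ m e∈V → V-disjoint-W e∈V (x∈p-y⇒x∈p m)) ⟩
    ∣ W - y ∣ + ∣ V ∣  ≡⟨ cong (∣ W - y ∣ +_) ∣V∣≡2 ⟩
    ∣ W - y ∣ + 2      ≡⟨ +-comm ∣ W - y ∣ 2 ⟩
    suc (suc ∣ W - y ∣) ≡⟨ cong suc (x∈p⇒suc∣p-x∣≡∣p∣ y∈W) ⟩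
    suc ∣ W ∣          ∎
    where
    open ≡-Reasoning
    ∣V∣≡2 : ∣ V ∣ ≡ 2
    ∣V∣≡2 = trans (∣p∪q∣≡∣p∣+∣q∣ ⁅ v₁ ⁆ ⁅ v₂ ⁆ λ m₁ m₂ → v₁≢v₂ (trans (sym (x∈⁅y⁆⇒x≡y v₁ m₁)) (x∈⁅y⁆⇒x≡y v₂ m₂)))
                  (cong₂ _+_ (∣⁅x⁆∣≡1 v₁) (∣⁅x⁆∣≡1 v₂))

lemma4 : (k n : ℕ) (G : Graph n) → 2 ≤ k → KConnected G 3 ⊤ → k + 3 ≤ n →
    (W : Subset n) → MContractible G (k ∸ 1) W →
    (v₁ v₂ v₃ v₄ : Fin n) →
    v₁ ≢ v₂ → v₁ ≢ v₃ → v₁ ≢ v₄ → v₂ ≢ v₃ → v₂ ≢ v₄ → v₃ ≢ v₄ →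
    v₁ ∉ W → v₂ ∉ W → v₃ ∉ W → v₄ ∉ W →
    Adj G v₁ v₂ →
    degMinus G W v₁ ≡ 2 → degMinus G W v₂ ≡ 2 →
    degMinus G W v₃ ≡ 2 → degMinus G W v₄ ≡ 2 →
    (∀ x → x ∈ W → Adj G x v₃ → Adj G x v₄ →
      KConnected G 2 (∁ ((W ─ ⁅ x ⁆) ∪ (⁅ v₁ ⁆ ∪ ⁅ v₂ ⁆)))) →
    ∣ W ─ (Nbr G v₁ ∪ Nbr G v₂) ∣ < ∣ (Nbr G v₃ ∩ Nbr G v₄) ∩ W ∣ →
    ∃ λ R → MContractible G k R
lemma4 (suc (suc j)) n G (s≤s (s≤s z≤n)) _ _ W ((W-connected , _) , ∣W∣≡1+j) v₁ v₂ v₃ v₄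
       v₁≢v₂ _ _ _ _ _ v₁∉W v₂∉W _ _ v₁~v₂ _ _ _ _ deletion-2-connected ∣W─N₁₂∣<∣C∣
  with connected-or-∣C∣≤∣W─N₁₂∣ G W v₁~v₂ v₁∉W v₂∉W W-connected C (p∩q⊆q (Nbr G v₃ ∩ Nbr G v₄) W)
  where
  C : Subset n
  C = (Nbr G v₃ ∩ Nbr G v₄) ∩ W
... | inj₂ ∣C∣≤∣W─N₁₂∣ = ⊥-elim (<⇒≱ ∣W─N₁₂∣<∣C∣ ∣C∣≤∣W─N₁₂∣)
... | inj₁ (x , x∈C , connected) = _ , ((connected , complement-2-connected) , ∣R∣≡k)
  where
  x∈N₃∩N₄ : x ∈ Nbr G v₃ ∩ Nbr G v₄
  x∈N₃∩N₄ = p∩q⊆p (Nbr G v₃ ∩ Nbr G v₄) W x∈C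

  x∈W : x ∈ W
  x∈W = p∩q⊆q (Nbr G v₃ ∩ Nbr G v₄) W x∈C

  complement-2-connected : KConnected G 2 (∁ ((W - x) ∪ (⁅ v₁ ⁆ ∪ ⁅ v₂ ⁆)))
  complement-2-connected = deletion-2-connected x x∈W
    (Adj-sym G (∈-tabulate⁻ (adj G v₃) (p∩q⊆p (Nbr G v₃) (Nbr G v₄) x∈N₃∩N₄)))
    (Adj-sym G (∈-tabulate⁻ (adj G v₄) (p∩q⊆q (Nbr G v₃) (Nbr G v₄) x∈N₃∩N₄)))

  ∣R∣≡k : ∣ (W - x) ∪ (⁅ v₁ ⁆ ∪ ⁅ v₂ ⁆) ∣ ≡ suc (suc j)
  ∣R∣≡k = trans (∣W-y∪V∣≡suc∣W∣ G W v₁~v₂ v₁∉W v₂∉W v₁≢v₂ x∈W) (cong suc ∣W∣≡1+j)
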